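{- Let $q=p^e$ with $p$ prime, $t\ge1$, $n\ge 2$, $d\ge 2$, and let $\boldsymbol{\sigma}=(\sigma_0,\ldots,\sigma_{d-1})$ with each $\sigma_i\in\mathrm{Gal}(\mathbb{F}_{q^t}|\mathbb{F}_q)$, $\sigma_i:x\mapsto x^{q^{h_i}}$, $0\le h_i<t$, such that $\sum_{i=0}^{d-1}q^{h_i}<q^t$. Let $\mathcal{V}_{d,\boldsymbol{\sigma}}$ be the image of the map $\nu_{d,\boldsymbol{\sigma}}:\langle v\rangle\in\mathrm{PG}(n-1,q^t)\mapsto\langle v^{\sigma_0}\otimes\cdots\otimes v^{\sigma_{d-1}}\rangle\in\mathrm{PG}\big((\mathbb{F}_{q^t}^n)^{\otimes d}\big)$. Then any $d+1$ distinct points of $\mathcal{V}_{d,\boldsymbol{\sigma}}$ are in general position, i.e. their representing vectors are linearly independent.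
   Context: For $v=(x_0,\ldots,x_{n-1})$ and a field automorphism $\sigma$, $v^\sigma=(x_0^\sigma,\ldots,x_{n-1}^\sigma)$. -}

module Defs where

open import Level using (Level; _⊔_) renaming (suc to lsuc)
open import Algebra.Bundles using (CommutativeRing; Semiring)
import Algebra.Definitions.RawSemiring as RS
open import Data.Nat.Base as ℕ using (ℕ; zero; suc)
open import Data.Fin.Base using (Fin; zero; suc)
open import Data.Product using (Σ; ∃; _×_)
open import Relation.Nullary using (¬_)
open import Relation.Binary.PropositionalEquality using (_≡_)

record Field (c ℓ : Level) : Set (lsuc (c ⊔ ℓ)) where
  field
    commutativeRing : CommutativeRing c ℓ
  open CommutativeRing commutativeRing public
  field
    1≉0     : ¬ (1# ≈ 0#)
    inverse : ∀ x → ¬ (x ≈ 0#) → ∃ λ y → x * y ≈ 1#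

natSum : ∀ {d} → (Fin d → ℕ) → ℕ
natSum {zero}  f = 0
natSum {suc d} f = f zero ℕ.+ natSum (λ i → f (suc i))

module _ {c ℓ} (F : Field c ℓ) where
  open Field F
  open RS (Semiring.rawSemiring semiring) using (sum; product; _^_)

  HasCardinality : ℕ → Set (c ⊔ ℓ)
  HasCardinality N =
    Σ (Fin N → Carrier) λ enum →
      (∀ i j → enum i ≈ enum j → i ≡ j) × (∀ x → ∃ λ i → enum i ≈ x)

  frob : ℕ → ℕ → Carrier → Carrier
  frob q h x = x ^ (q ℕ.^ h)

  -- v is a nonzero vector of F^n (so it represents a point ⟨v⟩ of PG(n-1,F)).
  NonZeroVec : ∀ {n} → (Fin n → Carrier) → Set ℓ
  NonZeroVec v = ¬ (∀ k → v k ≈ 0#)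

  -- ν_{d,σ}(v) = v^{σ_0} ⊗ ... ⊗ v^{σ_{d-1}}, with σ_i : x ↦ x^(q^(h i)),
  -- as an element of (F^n)^{⊗d}, coordinates indexed by f : Fin d → Fin n.
  veronese : ∀ {d n} → ℕ → (Fin d → ℕ) → (Fin n → Carrier) →
             (Fin d → Fin n) → Carrier
  veronese q h v f = product (λ i → frob q (h i) (v (f i)))

  SamePoint : ∀ {I : Set} → (I → Carrier) → (I → Carrier) → Set (c ⊔ ℓ)
  SamePoint w w' = ∃ λ a → ¬ (a ≈ 0#) × (∀ f → w f ≈ a * w' f)

  LinearlyIndependent : ∀ {m} {I : Set} → (Fin m → I → Carrier) → Set (c ⊔ ℓ)
  LinearlyIndependent {m} w =
    ∀ (a : Fin m → Carrier) →
      (∀ f → sum (λ j → a j * w j f) ≈ 0#) → ∀ j → a j ≈ 0#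

{-# OPTIONS --safe #-}
-- Fix one of the d+1 points, v₀ say.  For every factor i pair it with a different
-- point vᵢ and pick a 2×2 minor (α, β) on which vᵢ^σᵢ and v₀^σᵢ are not collinear;
-- such a minor exists because x ↦ x^(q^h) is injective on F_{q^t} (Fermat) and the
-- points are distinct.  Contracting the i-th tensor factor of a relation
-- ∑ⱼ aⱼ νⱼ = 0 against the linear form w ↦ vᵢ(α) w(β) − vᵢ(β) w(α) kills the term of
-- vᵢ and keeps the term of v₀ up to a nonzero scalar.  After all d contractions only
-- a₀ times a nonzero product survives, so a₀ = 0.
module Submission where

open import Defs
open import Data.Nat.Base using (ℕ; suc; _^_; _≤_; _<_)
open import Data.Nat.Primality using (Prime)
open import Data.Fin.Base using (Fin)
open import Relation.Nullary using (¬_)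
open import Relation.Binary.PropositionalEquality using (_≡_; _≢_)

open import Algebra.Bundles using (Semiring)
import Algebra.Definitions.RawSemiring as RawSemiringDefinitions
import Algebra.Properties.CommutativeMonoid.Sum as CommutativeMonoidSum
open import Data.Empty using (⊥-elim)
open import Data.Fin.Base using (zero; suc; punchIn; punchOut)
open import Data.Fin.Permutation using (Permutation; permutation)
open import Data.Fin.Properties
  using (_≟_; ¬Fin0; ¬∀⟶∃¬; all?; punchIn-injective; punchInᵢ≢i; punchIn-punchOut)
import Data.Nat.Base as ℕ
open import Data.Nat.Divisibility using (_∣_; divides)
import Data.Nat.Properties as ℕ
open import Data.Product using (∃; ∃₂; _×_; _,_; proj₁; proj₂)
open import Data.Vec.Functional using (_∷_)
open import Function.Base using (_∘_)
open import Level using (_⊔_)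
open import Relation.Binary.Definitions using (Decidable)
import Relation.Binary.PropositionalEquality as ≡
open import Relation.Nullary using (yes; no)
open import Relation.Nullary.Decidable using (map′)

^-∣-^ : ∀ q {h t} → h ≤ t → q ^ h ∣ q ^ t
^-∣-^ q {h} {t} h≤t = divides (q ^ (t ℕ.∸ h)) (begin
  q ^ t                        ≡⟨ ≡.cong (q ^_) (ℕ.m+[n∸m]≡n h≤t) ⟨
  q ^ (h ℕ.+ (t ℕ.∸ h))        ≡⟨ ℕ.^-distribˡ-+-* q h (t ℕ.∸ h) ⟩
  q ^ h ℕ.* q ^ (t ℕ.∸ h)      ≡⟨ ℕ.*-comm (q ^ h) _ ⟩
  q ^ (t ℕ.∸ h) ℕ.* q ^ h      ∎)
  where open ≡.≡-Reasoning

module _ {c ℓ} (F : Field c ℓ) where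
  open Field F hiding (zero)
  open RawSemiringDefinitions (Semiring.rawSemiring semiring)
    using (sum; product) renaming (_^_ to _^ᶠ_)
  open import Algebra.Properties.Ring ring using (-‿distribˡ-*)
  open import Algebra.Properties.Group +-group using (x∙y⁻¹≈ε⇒x≈y)
  open import Algebra.Properties.Semiring.Exp semiring using (^-congˡ; ^-congʳ; ^-assocʳ)
  open import Algebra.Properties.CommutativeSemiring.Exp commutativeSemiring
    using (^-distrib-*)
  open import Algebra.Properties.Semiring.Sum semiring
    using (sum-cong-≋; sum-replicate-zero; sum-remove; ∑-distrib-+; *-distribˡ-sum)
  module Product = CommutativeMonoidSum *-commutativeMonoid
  open import Algebra.Solver.Ring.NaturalCoefficients.Default commutativeSemiring
    using (solve; _:=_; _:*_; _:+_)
  open import Relation.Binary.Reasoning.Setoid setoid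

  product-cong : ∀ {m} {f g : Fin m → Carrier} → (∀ i → f i ≈ g i) → product f ≈ product g
  product-cong = Product.sum-cong-≋

  product-* : ∀ {m} (f g : Fin m → Carrier) → product (λ i → f i * g i) ≈ product f * product g
  product-* = Product.∑-distrib-+

  product-const : ∀ m x → product {m} (λ _ → x) ≈ x ^ᶠ m
  product-const m x = Product.sum-replicate m

  *-cancelʳ-≉0 : ∀ {x y z} → y ≉ 0# → x * y ≈ z * y → x ≈ z
  *-cancelʳ-≉0 {x} {y} {z} y≉0 xy≈zy with inverse y y≉0
  ... | y⁻¹ , yy⁻¹≈1 = begin
    x              ≈⟨ *-identityʳ x ⟨
    x * 1#         ≈⟨ *-congˡ yy⁻¹≈1 ⟨
    x * (y * y⁻¹)  ≈⟨ *-assoc x y y⁻¹ ⟨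
    x * y * y⁻¹    ≈⟨ *-congʳ xy≈zy ⟩
    z * y * y⁻¹    ≈⟨ *-assoc z y y⁻¹ ⟩
    z * (y * y⁻¹)  ≈⟨ *-congˡ yy⁻¹≈1 ⟩
    z * 1#         ≈⟨ *-identityʳ z ⟩
    z              ∎

  *-≉0 : ∀ {x y} → x ≉ 0# → y ≉ 0# → x * y ≉ 0#
  *-≉0 {y = y} x≉0 y≉0 xy≈0 = x≉0 (*-cancelʳ-≉0 y≉0 (trans xy≈0 (sym (zeroˡ y))))

  ^-≉0 : ∀ {x} n → x ≉ 0# → x ^ᶠ n ≉ 0#
  ^-≉0 ℕ.zero    x≉0 = 1≉0
  ^-≉0 (suc n) x≉0 = *-≉0 x≉0 (^-≉0 n x≉0)

  product-≉0 : ∀ {m} (f : Fin m → Carrier) → (∀ i → f i ≉ 0#) → product f ≉ 0#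
  product-≉0 {ℕ.zero}  f f≉0 = 1≉0
  product-≉0 {suc m} f f≉0 = *-≉0 (f≉0 zero) (product-≉0 (f ∘ suc) (f≉0 ∘ suc))

  product-≈0 : ∀ {m} (f : Fin m → Carrier) i → f i ≈ 0# → product f ≈ 0#
  product-≈0 f zero    fi≈0 = trans (*-congʳ fi≈0) (zeroˡ _)
  product-≈0 f (suc i) fi≈0 = trans (*-congˡ (product-≈0 (f ∘ suc) i fi≈0)) (zeroʳ _)

  sum≈0⇒single-term≈0 : ∀ {m} (g : Fin (suc m) → Carrier) j₀ →
                        (∀ j → j ≢ j₀ → g j ≈ 0#) → sum g ≈ 0# → g j₀ ≈ 0#
  sum≈0⇒single-term≈0 {m} g j₀ g≈0 ∑g≈0 = begin
    g j₀                            ≈⟨ +-identityʳ (g j₀) ⟨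
    g j₀ + 0#                       ≈⟨ +-congˡ (sum-replicate-zero m) ⟨
    g j₀ + sum {m} (λ _ → 0#)
      ≈⟨ +-congˡ (sum-cong-≋ λ k → g≈0 (punchIn j₀ k) (punchInᵢ≢i j₀ k)) ⟨
    g j₀ + sum (g ∘ punchIn j₀)     ≈⟨ sum-remove {i = j₀} g ⟨
    sum g                           ≈⟨ ∑g≈0 ⟩
    0#                              ∎

  ⨂ : ∀ {d n} → (Fin d → Fin n → Carrier) → (Fin d → Fin n) → Carrier
  ⨂ w f = product (λ i → w i (f i))

  LinearRelation : ∀ {m d n} → (Fin m → Carrier) → (Fin m → Fin d → Fin n → Carrier) → Set ℓ
  LinearRelation a w = ∀ f → sum (λ j → a j * ⨂ (w j) f) ≈ 0#

  minor : ∀ {n} → (Fin n → Carrier) → (Fin n → Carrier) → Fin n → Fin n → Carrier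
  minor u w α β = u α * w β - u β * w α

  minor-self : ∀ {n} (u : Fin n → Carrier) α β → minor u u α β ≈ 0#
  minor-self u α β = trans (+-congˡ (-‿cong (*-comm (u β) (u α)))) (-‿inverseʳ _)

  minor-linear : ∀ {n} (u w : Fin n → Carrier) α β → minor u w α β ≈ u α * w β + (- u β) * w α
  minor-linear u w α β = +-congˡ (-‿distribˡ-* (u β) (w α))

  contract-head : ∀ {m d n} (a : Fin m → Carrier) (w : Fin m → Fin (suc d) → Fin n → Carrier)
                  (u : Fin n → Carrier) α β → LinearRelation a w →
                  LinearRelation (λ j → a j * minor u (w j zero) α β) (λ j → w j ∘ suc)
  contract-head a w u α β rel f = begin
    sum (λ j → a j * minor u (w j zero) α β * P j)      ≈⟨ sum-cong-≋ expand ⟩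
    sum (λ j → u α * T β j + (- u β) * T α j)
      ≈⟨ ∑-distrib-+ (λ j → u α * T β j) (λ j → (- u β) * T α j) ⟩
    sum (λ j → u α * T β j) + sum (λ j → (- u β) * T α j)
      ≈⟨ +-cong (*-distribˡ-sum (u α) (T β)) (*-distribˡ-sum (- u β) (T α)) ⟨
    u α * sum (T β) + (- u β) * sum (T α)
      ≈⟨ +-cong (*-congˡ (rel (β ∷ f))) (*-congˡ (rel (α ∷ f))) ⟩
    u α * 0# + (- u β) * 0#                            ≈⟨ +-cong (zeroʳ _) (zeroʳ _) ⟩
    0# + 0#                                            ≈⟨ +-identityʳ 0# ⟩
    0#                                                 ∎
    where
    P : _ → Carrier
    P j = ⨂ (w j ∘ suc) f
    T : _ → _ → Carrier
    T γ j = a j * ⨂ (w j) (γ ∷ f)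
    expand : ∀ j → a j * minor u (w j zero) α β * P j ≈ u α * T β j + (- u β) * T α j
    expand j = trans (*-congʳ (*-congˡ (minor-linear u (w j zero) α β)))
      (solve 6 (λ a x y p q r → a :* (x :* p :+ y :* q) :* r
                                := x :* (a :* (p :* r)) :+ y :* (a :* (q :* r)))
             refl (a j) (u α) (- u β) (w j zero β) (w j zero α) (P j))

  contract : ∀ {m d n} (a : Fin m → Carrier) (w : Fin m → Fin d → Fin n → Carrier)
             (u : Fin d → Fin n → Carrier) (α β : Fin d → Fin n) → LinearRelation a w →
             sum (λ j → a j * product (λ i → minor (u i) (w j i) (α i) (β i))) ≈ 0#
  contract {d = ℕ.zero} a w u α β rel = rel (λ ())
  contract {d = suc d}  a w u α β rel = begin
    sum (λ j → a j * (M j zero * product (M j ∘ suc)))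
      ≈⟨ sum-cong-≋ (λ j → *-assoc (a j) (M j zero) (product (M j ∘ suc))) ⟨
    sum (λ j → a j * M j zero * product (M j ∘ suc))
      ≈⟨ contract (λ j → a j * M j zero) (λ j → w j ∘ suc) (u ∘ suc) (α ∘ suc) (β ∘ suc)
                  (contract-head a w (u zero) (α zero) (β zero) rel) ⟩
    0#                                                  ∎
    where
    M : _ → _ → Carrier
    M j i = minor (u i) (w j i) (α i) (β i)

  HasNonzeroMinor : ∀ {n} → (Fin n → Carrier) → (Fin n → Carrier) → Set ℓ
  HasNonzeroMinor u w = ∃₂ λ α β → minor u w α β ≉ 0#

  separated-coefficient-≈0 :
    ∀ {m d n} (a : Fin (suc m) → Carrier) (w : Fin (suc m) → Fin d → Fin n → Carrier) j₀
    (k : Fin d → Fin (suc m)) → (∀ j → j ≢ j₀ → ∃ λ i → k i ≡ j) →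
    (∀ i → HasNonzeroMinor (w (k i) i) (w j₀ i)) → LinearRelation a w → a j₀ ≈ 0#
  separated-coefficient-≈0 a w j₀ k covers separated rel =
    *-cancelʳ-≉0 (product-≉0 (Π j₀) (proj₂ ∘ proj₂ ∘ separated))
      (trans (sum≈0⇒single-term≈0 _ j₀ others-vanish (contract a w u α β rel)) (sym (zeroˡ _)))
    where
    u : _ → _ → Carrier
    u i = w (k i) i
    α β : _ → _
    α = proj₁ ∘ separated
    β = proj₁ ∘ proj₂ ∘ separated
    Π : _ → _ → Carrier
    Π j i = minor (u i) (w j i) (α i) (β i)
    others-vanish : ∀ j → j ≢ j₀ → a j * product (Π j) ≈ 0#
    others-vanish j j≢j₀ with covers j j≢j₀
    ... | i , ≡.refl =
      trans (*-congˡ (product-≈0 (Π j) i (minor-self (w j i) (α i) (β i)))) (zeroʳ (a j))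

  module _ {N} (card : HasCardinality F N) where
    private
      enum : Fin N → Carrier
      enum = proj₁ card
      enum-injective : ∀ i j → enum i ≈ enum j → i ≡ j
      enum-injective = proj₁ (proj₂ card)

    index : Carrier → Fin N
    index x = proj₁ (proj₂ (proj₂ card) x)

    enum-index : ∀ x → enum (index x) ≈ x
    enum-index x = proj₂ (proj₂ (proj₂ card) x)

    ≈-dec : Decidable _≈_
    ≈-dec x y = map′
      (λ i≡j → trans (sym (enum-index x)) (trans (reflexive (≡.cong enum i≡j)) (enum-index y)))
      (λ x≈y → enum-injective _ _ (trans (enum-index x) (trans x≈y (sym (enum-index y)))))
      (index x ≟ index y)

  module _ {M} (card : HasCardinality F (suc M)) where
    private
      enum : Fin (suc M) → Carrier
      enum = proj₁ card
      enum-injective : ∀ i j → enum i ≈ enum j → i ≡ j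
      enum-injective = proj₁ (proj₂ card)
      i₀ : Fin (suc M)
      i₀ = index card 0#

    unit : Fin M → Carrier
    unit j = enum (punchIn i₀ j)

    unit-≉0 : ∀ j → unit j ≉ 0#
    unit-≉0 j u≈0 = punchInᵢ≢i i₀ j (enum-injective _ _ (trans u≈0 (sym (enum-index card 0#))))

    unit-injective : ∀ {i j} → unit i ≈ unit j → i ≡ j
    unit-injective ui≈uj = punchIn-injective i₀ _ _ (enum-injective _ _ ui≈uj)

    unitIndex : ∀ z → z ≉ 0# → Fin M
    unitIndex z z≉0 = punchOut {i = i₀} {j = index card z} λ i₀≡iz →
      z≉0 (trans (sym (enum-index card z))
                 (trans (reflexive (≡.cong enum (≡.sym i₀≡iz))) (enum-index card 0#)))

    unit-unitIndex : ∀ z (z≉0 : z ≉ 0#) → unit (unitIndex z z≉0) ≈ z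
    unit-unitIndex z z≉0 = trans (reflexive (≡.cong enum (punchIn-punchOut _))) (enum-index card z)

    scale : ∀ x → x ≉ 0# → Fin M → Fin M
    scale x x≉0 j = unitIndex (x * unit j) (*-≉0 x≉0 (unit-≉0 j))

    unit-scale : ∀ x (x≉0 : x ≉ 0#) j → unit (scale x x≉0 j) ≈ x * unit j
    unit-scale x x≉0 j = unit-unitIndex (x * unit j) (*-≉0 x≉0 (unit-≉0 j))

    scale-inverse : ∀ {x y} (x≉0 : x ≉ 0#) (y≉0 : y ≉ 0#) → x * y ≈ 1# →
                    ∀ j → scale x x≉0 (scale y y≉0 j) ≡ j
    scale-inverse {x} {y} x≉0 y≉0 xy≈1 j = unit-injective (begin
      unit (scale x x≉0 (scale y y≉0 j))  ≈⟨ unit-scale x x≉0 (scale y y≉0 j) ⟩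
      x * unit (scale y y≉0 j)            ≈⟨ *-congˡ (unit-scale y y≉0 j) ⟩
      x * (y * unit j)                    ≈⟨ *-assoc x y (unit j) ⟨
      x * y * unit j                      ≈⟨ *-congʳ xy≈1 ⟩
      1# * unit j                         ≈⟨ *-identityˡ (unit j) ⟩
      unit j                              ∎)

    scale-permutation : ∀ x → x ≉ 0# → Permutation M M
    scale-permutation x x≉0 with inverse x x≉0
    ... | y , xy≈1 = permutation (scale x x≉0) (scale y y≉0)
      (scale-inverse x≉0 y≉0 xy≈1) (scale-inverse y≉0 x≉0 (trans (*-comm y x) xy≈1))
      where
      y≉0 : y ≉ 0#
      y≉0 y≈0 = 1≉0 (trans (sym xy≈1) (trans (*-congˡ y≈0) (zeroʳ x)))

    -- Multiplying by x permutes the units, so ∏ unit = x^M ∏ unit.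
    ^-units≈1 : ∀ {x} → x ≉ 0# → x ^ᶠ M ≈ 1#
    ^-units≈1 {x} x≉0 = *-cancelʳ-≉0 (product-≉0 unit unit-≉0) (begin
      x ^ᶠ M * product unit                ≈⟨ *-congʳ (product-const M x) ⟨
      product {M} (λ _ → x) * product unit ≈⟨ product-* (λ _ → x) unit ⟨
      product (λ j → x * unit j)           ≈⟨ product-cong (unit-scale x x≉0) ⟨
      product (unit ∘ scale x x≉0)         ≈⟨ Product.sum-permute unit (scale-permutation x x≉0) ⟨
      product unit                         ≈⟨ *-identityˡ _ ⟨
      1# * product unit                    ∎)

    fermat-suc : ∀ x → x ^ᶠ suc M ≈ x
    fermat-suc x with ≈-dec card x 0#
    ... | yes x≈0 = trans (*-congʳ x≈0) (trans (zeroˡ _) (sym x≈0))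
    ... | no x≉0  = trans (*-congˡ (^-units≈1 x≉0)) (*-identityʳ x)

  fermat : ∀ {N} → HasCardinality F N → ∀ x → x ^ᶠ N ≈ x
  fermat {ℕ.zero} card x = ⊥-elim (¬Fin0 (index card x))
  fermat {suc M}  card x = fermat-suc card x

  ^-injective : ∀ {N M} → HasCardinality F N → M ∣ N → ∀ {x y} → x ^ᶠ M ≈ y ^ᶠ M → x ≈ y
  ^-injective {N} {M} card (divides K N≡KM) {x} {y} xᴹ≈yᴹ = begin
    x              ≈⟨ fermat card x ⟨
    x ^ᶠ N         ≈⟨ ^-congʳ x N≡MK ⟩
    x ^ᶠ (M ℕ.* K) ≈⟨ ^-assocʳ x M K ⟨
    (x ^ᶠ M) ^ᶠ K  ≈⟨ ^-congˡ K xᴹ≈yᴹ ⟩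
    (y ^ᶠ M) ^ᶠ K  ≈⟨ ^-assocʳ y M K ⟩
    y ^ᶠ (M ℕ.* K) ≈⟨ ^-congʳ y N≡MK ⟨
    y ^ᶠ N         ≈⟨ fermat card y ⟩
    y              ∎
    where
    N≡MK : N ≡ M ℕ.* K
    N≡MK = ≡.trans N≡KM (ℕ.*-comm K M)

  Proportional : ∀ {n} → (Fin n → Carrier) → (Fin n → Carrier) → Set (c ⊔ ℓ)
  Proportional u w = ∃ λ l → l ≉ 0# × (∀ k → u k ≈ l * w k)

  veronese-proportional : ∀ {d n} q (h : Fin d → ℕ) {u w : Fin n → Carrier} →
                          Proportional u w → SamePoint F (veronese F q h u) (veronese F q h w)
  veronese-proportional q h {u} {w} (l , l≉0 , u≈lw) =
    product σl , product-≉0 σl (λ i → ^-≉0 (q ^ h i) l≉0) , λ f → begin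
      product (λ i → frob F q (h i) (u (f i)))
        ≈⟨ product-cong (λ i → ^-congˡ (q ^ h i) (u≈lw (f i))) ⟩
      product (λ i → frob F q (h i) (l * w (f i)))
        ≈⟨ product-cong (λ i → ^-distrib-* l (w (f i)) (q ^ h i)) ⟩
      product (λ i → σl i * frob F q (h i) (w (f i)))
        ≈⟨ product-* σl (λ i → frob F q (h i) (w (f i))) ⟩
      product σl * product (λ i → frob F q (h i) (w (f i)))  ∎
    where
    σl : Fin _ → Carrier
    σl i = frob F q (h i) l

  Collinear : ∀ {n} → (Fin n → Carrier) → (Fin n → Carrier) → Set ℓ
  Collinear u w = ∀ α β → u α * w β ≈ u β * w α

  module _ {N} (card : HasCardinality F N) where
    nonzero-coordinate : ∀ {n} {w : Fin n → Carrier} → NonZeroVec F w → ∃ λ α → w α ≉ 0#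
    nonzero-coordinate {n} w≢0 = ¬∀⟶∃¬ n _ (λ α → ≈-dec card _ 0#) w≢0

    ¬collinear⇒hasNonzeroMinor : ∀ {n} {u w : Fin n → Carrier} →
                                 ¬ Collinear u w → HasNonzeroMinor u w
    ¬collinear⇒hasNonzeroMinor {n} {u} {w} ¬col
      with ¬∀⟶∃¬ n _ (λ α → all? (λ β → ≈-dec card _ _)) ¬col
    ... | α , ¬colα with ¬∀⟶∃¬ n _ (λ β → ≈-dec card _ _) ¬colα
    ... | β , ¬colαβ = α , β , ¬colαβ ∘ x∙y⁻¹≈ε⇒x≈y _ _

    collinear⇒proportional : ∀ {n} {u w : Fin n → Carrier} →
                             NonZeroVec F u → NonZeroVec F w → Collinear u w → Proportional u w
    collinear⇒proportional {u = u} {w} u≢0 w≢0 col with nonzero-coordinate w≢0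
    ... | α , wα≉0 with inverse (w α) wα≉0
    ... | z , wαz≈1 = l , l≉0 , u≈lw
      where
      l : Carrier
      l = u α * z
      u≈lw : ∀ β → u β ≈ l * w β
      u≈lw β = begin
        u β                ≈⟨ *-identityʳ (u β) ⟨
        u β * 1#           ≈⟨ *-congˡ wαz≈1 ⟨
        u β * (w α * z)    ≈⟨ *-assoc (u β) (w α) z ⟨
        u β * w α * z      ≈⟨ *-congʳ (col α β) ⟨
        u α * w β * z      ≈⟨ solve 3 (λ a b c → a :* b :* c := a :* c :* b) refl (u α) (w β) z ⟩
        l * w β            ∎
      l≉0 : l ≉ 0#
      l≉0 l≈0 = u≢0 λ β → trans (u≈lw β) (trans (*-congʳ l≈0) (zeroˡ (w β)))

    ^-collinear : ∀ {M n} → M ∣ N → {u w : Fin n → Carrier} →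
                  Collinear (λ k → u k ^ᶠ M) (λ k → w k ^ᶠ M) → Collinear u w
    ^-collinear {M} M∣N {u} {w} col α β = ^-injective card M∣N (begin
      (u α * w β) ^ᶠ M        ≈⟨ ^-distrib-* (u α) (w β) M ⟩
      u α ^ᶠ M * w β ^ᶠ M     ≈⟨ col α β ⟩
      u β ^ᶠ M * w α ^ᶠ M     ≈⟨ ^-distrib-* (u β) (w α) M ⟨
      (u β * w α) ^ᶠ M        ∎)

    ^-hasNonzeroMinor : ∀ {M n} → M ∣ N → {u w : Fin n → Carrier} →
                        NonZeroVec F u → NonZeroVec F w → ¬ Proportional u w →
                        HasNonzeroMinor (λ k → u k ^ᶠ M) (λ k → w k ^ᶠ M)
    ^-hasNonzeroMinor M∣N u≢0 w≢0 ¬prop = ¬collinear⇒hasNonzeroMinor λ col →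
      ¬prop (collinear⇒proportional u≢0 w≢0 (^-collinear M∣N col))

mainTheorem2 : ∀ {c ℓ} (F : Field c ℓ) (p e q t n d : ℕ) →
    Prime p → 1 ≤ e → q ≡ p ^ e → 1 ≤ t → 2 ≤ n → 2 ≤ d →
    HasCardinality F (q ^ t) →
    (h : Fin d → ℕ) → (∀ i → h i < t) → natSum (λ i → q ^ h i) < q ^ t →
    (v : Fin (suc d) → Fin n → Field.Carrier F) →
    (∀ j → NonZeroVec F (v j)) →
    (∀ j k → j ≢ k → ¬ SamePoint F (veronese F q h (v j)) (veronese F q h (v k))) →
    LinearlyIndependent F (λ j → veronese F q h (v j))
mainTheorem2 F p e q t n d _ _ _ _ _ _ card h h<t _ v v≢0 distinct a rel j₀ =
  separated-coefficient-≈0 F a (λ j i → frob F q (h i) ∘ v j) j₀ (punchIn j₀) covers separated rel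
  where
  covers : ∀ j → j ≢ j₀ → ∃ λ i → punchIn j₀ i ≡ j
  covers j j≢j₀ = punchOut (j≢j₀ ∘ ≡.sym) , punchIn-punchOut _
  separated : ∀ i → HasNonzeroMinor F (frob F q (h i) ∘ v (punchIn j₀ i)) (frob F q (h i) ∘ v j₀)
  separated i = ^-hasNonzeroMinor F card (^-∣-^ q (ℕ.<⇒≤ (h<t i))) (v≢0 _) (v≢0 j₀)
    (distinct _ j₀ (punchInᵢ≢i j₀ i) ∘ veronese-proportional F q h)
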